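{- Let $G$ be a finite group (written additively, not necessarily abelian), let $f:G\to G$, and let $S$ be a $k$-subset of $G$ with $k\ge u(f)$. Then there is a one-to-$\prod_{t=1}^{u(f)} (t!)^{\#P_t}$ correspondence between the set of all admissible subtables of $M_f$ with value set $S$ and the set of all functions $g:G\to G$ such that (a) $\operatorname{Im}(g)=S$, and (b) $g$ is injective on $\operatorname{Pre}(f,c)$ for every $c\in\operatorname{Im}(f)$, i.e. $g(x)\ne g(y)$ whenever $x\ne y$ and $f(x)=f(y)$. That is, each admissible subtable with value set $S$ corresponds to exactly $\prod_{t=1}^{u(f)} (t!)^{\#P_t}$ such functions $g$, and each such $g$ corresponds to exactly one admissible subtable. Moreover, if two functions $g$ and $h$ correspond to the same admissible subtable, then $\operatorname{Im}(g)=\operatorname{Im}(h)$ and $\operatorname{Im}(g+f)=\operatorname{Im}(h+f)$.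
   Context: For $g:G\to G$, $\operatorname{Im}(g)=\{g(x):x\in G\}$ and $g+f$ denotes $x\mapsto g(x)+f(x)$. For $b\in G$, $\operatorname{Pre}(f,b)=\{x\in G: f(x)=b\}$, and the uniformity of $f$ is $u(f)=\max_{b\in G}\#\operatorname{Pre}(f,b)$. For $0\le t\le u(f)$, $P_t=\{b\in G:\#\operatorname{Pre}(f,b)=t\}$. The subtraction table $M_f$ of $f$ has rows indexed by $G$ and columns indexed by $\operatorname{Im}(f)$; the entry in position $(r,c)$ is $m_{r,c}=r-c$. A subtable is any collection of entries (positions) of $M_f$. A subtable $\mathcal{A}$ is an admissible subtable with value set $S$ if (A1) $S$ is exactly the set of values of the entries in $\mathcal{A}$, and (A2) for every $c\in\operatorname{Im}(f)$ there are exactly $\#\operatorname{Pre}(f,c)$ distinct rows $r$ with $m_{r,c}\in\mathcal{A}$. The correspondence is: $g$ corresponds to the subtable consisting of the entries $m_{r,c}$ for which there is $x\in G$ with $f(x)=c$ and $g(x)+f(x)=r$ (so $g(x)=m_{r,c}$). -}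

module Defs where

open import Data.Nat as ℕ using (ℕ; suc; _⊔_; _^_; _!)
open import Data.Fin using (Fin)
open import Data.Fin.Properties using (_≟_)
open import Data.Fin.Subset using (Subset; _∈_; ∣_∣)
open import Data.Vec using (tabulate)
open import Data.List using (List; map; foldr; upTo; length; allFin)
open import Data.Nat.ListAction using (product)
open import Data.List.Relation.Unary.Any using (Any)
open import Data.List.Relation.Unary.AllPairs using (AllPairs)
open import Data.Product using (Σ; ∃; ∃₂; _×_)
open import Data.Bool using (Bool; true)
open import Relation.Nullary using (¬_; does)
open import Relation.Binary.PropositionalEquality using (_≡_; _≢_; _≗_)
open import Function.Bundles using (_⇔_)
open import Algebra.Core using (Op₁; Op₂)
open import Algebra.Structures using (IsGroup)

-- A finite group of order n, written additively (not necessarily abelian).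
-- Every finite group is isomorphic to one whose carrier is Fin n.
record FinGroup (n : ℕ) : Set where
  infixl 6 _+_ _-_
  field
    _+_ : Op₂ (Fin n)
    0# : Fin n
    -_ : Op₁ (Fin n)
    isGroup : IsGroup _≡_ _+_ 0# -_
  _-_ : Op₂ (Fin n)
  x - y = x + (- y)

module _ {n : ℕ} where

  InIm : (Fin n → Fin n) → Fin n → Set
  InIm g b = ∃ λ x → g x ≡ b

  SameIm : (Fin n → Fin n) → (Fin n → Fin n) → Set
  SameIm g h = ∀ b → InIm g b ⇔ InIm h b

  Pre : (Fin n → Fin n) → Fin n → Subset n
  Pre f b = tabulate (λ x → does (f x ≟ b))

  #Pre : (Fin n → Fin n) → Fin n → ℕ
  #Pre f b = ∣ Pre f b ∣

  u : (Fin n → Fin n) → ℕ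
  u f = foldr _⊔_ 0 (map (#Pre f) (allFin n))

  #P : (Fin n → Fin n) → ℕ → ℕ
  #P f t = ∣ tabulate (λ b → does (#Pre f b ℕ.≟ t)) ∣

  multiplicity : (Fin n → Fin n) → ℕ
  multiplicity f = product (map (λ t → (t !) ^ #P f t) (map suc (upTo (u f))))

  -- A subtable of M_f: a set of positions (r , c), r = row, c = column,
  -- given by its characteristic function.
  Subtable : Set
  Subtable = Fin n → Fin n → Bool

  -- only columns indexed by Im(f) exist in M_f
  IsSubtableOf : (Fin n → Fin n) → Subtable → Set
  IsSubtableOf f A = ∀ r c → A r c ≡ true → InIm f c

  SameSubtable : Subtable → Subtable → Set
  SameSubtable A B = ∀ r c → A r c ≡ B r c

  #rows : Subtable → Fin n → ℕ
  #rows A c = ∣ tabulate (λ r → A r c) ∣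

  module _ (G : FinGroup n) where
    open FinGroup G

    -- admissible subtable of M_f with value set S (entry m_{r,c} = r - c)
    Admissible : (Fin n → Fin n) → Subset n → Subtable → Set
    Admissible f S A =
      IsSubtableOf f A
      × (∀ s → s ∈ S ⇔ (∃₂ λ r c → A r c ≡ true × r - c ≡ s))
      × (∀ c → InIm f c → #rows A c ≡ #Pre f c)

    Corresponds : (Fin n → Fin n) → (Fin n → Fin n) → Subtable → Set
    Corresponds f g A = ∀ r c → A r c ≡ true ⇔ (∃ λ x → f x ≡ c × g x + f x ≡ r)

  Good : (Fin n → Fin n) → Subset n → (Fin n → Fin n) → Set
  Good f S g =
    (∀ b → InIm g b ⇔ b ∈ S)
    × (∀ x y → x ≢ y → f x ≡ f y → g x ≢ g y)

  -- the predicate P on functions G → G (which respects pointwise equality)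
  -- has exactly N solutions, counted up to pointwise equality
  HasExactly : ((Fin n → Fin n) → Set) → ℕ → Set
  HasExactly P N = Σ (List (Fin n → Fin n)) λ L →
    length L ≡ N
    × AllPairs (λ g h → ¬ (g ≗ h)) L
    × (∀ g → P g ⇔ Any (λ h → g ≗ h) L)

module Submission where

-- Put σ = g + f.  Then g corresponds to A exactly when A is the graph {(σ x , f x)} of (σ , f),
-- condition (b) on g says that σ is injective on the fibres of f, and condition (a) then says
-- that A has value set S.  So the functions g belonging to an admissible A are the σ that
-- realise A: in each column c, σ maps Pre(f,c) bijectively onto the #Pre(f,c) rows of A,
-- giving ∏_c #Pre(f,c)! of them, and grouping the columns by t = #Pre(f,c) gives
-- ∏_t (t!)^#P_t.  The realisations are enumerated by choosing σ 0 among the rows of column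
-- f 0, deleting that entry and recursing on the rest of the domain.

open import Algebra.Bundles using (Group)
import Algebra.Properties.Group as GroupProperties
open import Data.Bool using (Bool; true; false; _∧_; not; if_then_else_)
open import Data.Bool.Properties using (∧-identityʳ; ∧-zeroʳ; ¬-not)
open import Data.Fin as Fin using (Fin; zero; suc)
open import Data.Fin.Properties using (_≟_; suc-injective; any?)
open import Data.Fin.Subset using (Subset; ∣_∣; _∈_)
open import Data.List using (List; []; _∷_; [_]; map; concatMap; foldr; length; upTo)
open import Data.List.Properties using (map-cong; length-map; length-++)
open import Data.List.Membership.Propositional using () renaming (_∈_ to _∈ˡ_)
open import Data.List.Membership.Propositional.Properties using (∈-map⁺; ∈-allFin; ∈-upTo⁺)
open import Data.List.Relation.Unary.All as All using (All; []; _∷_)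
import Data.List.Relation.Unary.All.Properties as All
open import Data.List.Relation.Unary.Any as Any using (Any; here; there)
import Data.List.Relation.Unary.Any.Properties as Any
open import Data.List.Relation.Unary.AllPairs as AllPairs using (AllPairs; []; _∷_)
import Data.List.Relation.Unary.AllPairs.Properties as AllPairs
open import Data.List.Relation.Unary.Unique.Propositional using (Unique)
import Data.List.Relation.Unary.Unique.Propositional.Properties as Unique
open import Data.Nat as ℕ using (ℕ; zero; suc; _*_; _^_; _!; _⊔_; _≤_)
import Data.Nat.Properties as ℕ
open import Data.Nat.ListAction using (product)
open import Data.Product using (Σ; ∃; ∃₂; _×_; _,_; proj₁; proj₂)
open import Data.Sum using (_⊎_; inj₁; inj₂)
open import Data.Vec using (tabulate)
open import Data.Vec.Properties using (tabulate-cong)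
open import Data.Vec.Functional using () renaming (_∷_ to _∷ᶠ_)
open import Data.Vec.Functional.Properties using (∷-cong)
open import Function using (_∘_; id)
open import Function.Bundles using (_⇔_; mk⇔; module Equivalence)
import Function.Properties.Equivalence as ⇔
open import Level using (0ℓ)
open import Relation.Binary.PropositionalEquality
  using (_≡_; _≢_; _≗_; refl; sym; trans; cong; cong₂; module ≡-Reasoning)
open import Relation.Nullary using (Dec; does; ¬_; yes; no; contradiction)
open import Relation.Nullary.Decidable using (dec-true; dec-false; _×-dec_)
open import Algebra.Properties.CommutativeMonoid.Sum ℕ.*-1-commutativeMonoid
  using () renaming (sum to ∏; sum-cong-≗ to ∏-cong; sum-replicate-zero to ∏-replicate-one)
open import Algebra.Properties.CommutativeSemigroup ℕ.*-commutativeSemigroup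
  using (x∙yz≈y∙xz; interchange)

open import Defs

open Equivalence using (to; from)

does≡true⇔ : ∀ {P : Set} (P? : Dec P) → does P? ≡ true ⇔ P
does≡true⇔ (yes p) = mk⇔ (λ _ → p) (λ _ → refl)
does≡true⇔ (no ¬p) = mk⇔ (λ ()) (λ p → contradiction p ¬p)

≡true⇔≡true⇒≡ : ∀ {a b} → (a ≡ true ⇔ b ≡ true) → a ≡ b
≡true⇔≡true⇒≡ {true}  {true}  _   = refl
≡true⇔≡true⇒≡ {false} {false} _   = refl
≡true⇔≡true⇒≡ {true}  {false} a⇔b = sym (to a⇔b refl)
≡true⇔≡true⇒≡ {false} {true}  a⇔b = from a⇔b refl

-- Counting

toℕᵇ : Bool → ℕ
toℕᵇ false = 0
toℕᵇ true  = 1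

count : ∀ {m} → (Fin m → Bool) → ℕ
count p = ∣ tabulate p ∣

count-cong : ∀ {m} {p q : Fin m → Bool} → p ≗ q → count p ≡ count q
count-cong p≗q = cong ∣_∣ (tabulate-cong p≗q)

count-head : ∀ {m} (p : Fin (suc m) → Bool) → count p ≡ toℕᵇ (p zero) ℕ.+ count (p ∘ suc)
count-head p with p zero
... | true  = refl
... | false = refl

count-false : ∀ {m} (p : Fin m → Bool) → (∀ i → p i ≡ false) → count p ≡ 0
count-false {zero}  p p≡false = refl
count-false {suc m} p p≡false = begin
  count p                             ≡⟨ count-head p ⟩
  toℕᵇ (p zero) ℕ.+ count (p ∘ suc)   ≡⟨ cong₂ ℕ._+_ (cong toℕᵇ (p≡false zero))
                                                    (count-false (p ∘ suc) (p≡false ∘ suc)) ⟩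
  0                                   ∎
  where open ≡-Reasoning

_without_ : ∀ {m} → (Fin m → Bool) → Fin m → Fin m → Bool
(p without i) j = p j ∧ not (does (j ≟ i))

count-without : ∀ {m} (p : Fin m → Bool) i → p i ≡ true → count p ≡ suc (count (p without i))
count-without {suc m} p zero p0≡true = begin
  count p                                     ≡⟨ count-head p ⟩
  toℕᵇ (p zero) ℕ.+ count (p ∘ suc)           ≡⟨ cong₂ ℕ._+_ (cong toℕᵇ p0≡true)
                                                     (count-cong λ j → sym (∧-identityʳ (p (suc j)))) ⟩
  suc (count (p′ ∘ suc))                      ≡⟨ cong (λ b → suc (toℕᵇ b ℕ.+ count (p′ ∘ suc)))
                                                     (∧-zeroʳ (p zero)) ⟨
  suc (toℕᵇ (p′ zero) ℕ.+ count (p′ ∘ suc))   ≡⟨ cong suc (count-head p′) ⟨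
  suc (count p′)                              ∎
  where
  open ≡-Reasoning
  p′ = p without zero
count-without {suc m} p (suc i) pi≡true = begin
  count p                                     ≡⟨ count-head p ⟩
  toℕᵇ (p zero) ℕ.+ count (p ∘ suc)           ≡⟨ cong (toℕᵇ (p zero) ℕ.+_)
                                                     (count-without (p ∘ suc) i pi≡true) ⟩
  toℕᵇ (p zero) ℕ.+ suc (count (p′ ∘ suc))    ≡⟨ ℕ.+-suc _ _ ⟩
  suc (toℕᵇ (p zero) ℕ.+ count (p′ ∘ suc))    ≡⟨ cong (λ b → suc (toℕᵇ b ℕ.+ count (p′ ∘ suc)))
                                                     (∧-identityʳ (p zero)) ⟨
  suc (toℕᵇ (p′ zero) ℕ.+ count (p′ ∘ suc))   ≡⟨ cong suc (count-head p′) ⟨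
  suc (count p′)                              ∎
  where
  open ≡-Reasoning
  p′ = p without suc i

trueIndices : ∀ {k} → (Fin k → Bool) → List (Fin k)
trueIndices {zero}  p = []
trueIndices {suc k} p = (if p zero then zero ∷_ else id) (map suc (trueIndices (p ∘ suc)))

length-trueIndices : ∀ {k} (p : Fin k → Bool) → length (trueIndices p) ≡ count p
length-trueIndices {zero}  p = refl
length-trueIndices {suc k} p with p zero
... | true  = cong suc (trans (length-map (Fin.suc {k}) (trueIndices (p ∘ suc))) (length-trueIndices (p ∘ suc)))
... | false = trans (length-map (Fin.suc {k}) (trueIndices (p ∘ suc))) (length-trueIndices (p ∘ suc))

trueIndices-true : ∀ {k} (p : Fin k → Bool) → All (λ i → p i ≡ true) (trueIndices p)
trueIndices-true {zero}  p = []
trueIndices-true {suc k} p with p zero in p0≡b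
... | true  = p0≡b ∷ All.map⁺ (trueIndices-true (p ∘ suc))
... | false = All.map⁺ (trueIndices-true (p ∘ suc))

∈-trueIndices : ∀ {k} (p : Fin k → Bool) {i} → p i ≡ true → i ∈ˡ trueIndices p
∈-trueIndices {suc k} p {zero}  pi≡true rewrite pi≡true = here refl
∈-trueIndices {suc k} p {suc i} pi≡true with p zero
... | true  = there (∈-map⁺ suc (∈-trueIndices (p ∘ suc) pi≡true))
... | false = ∈-map⁺ suc (∈-trueIndices (p ∘ suc) pi≡true)

trueIndices-unique : ∀ {k} (p : Fin k → Bool) → Unique (trueIndices p)
trueIndices-unique {zero}  p = []
trueIndices-unique {suc k} p with p zero
... | true  = All.map⁺ (All.universal (λ _ ()) _) ∷ tail-unique
  where tail-unique = Unique.map⁺ suc-injective (trueIndices-unique (p ∘ suc))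
... | false = Unique.map⁺ suc-injective (trueIndices-unique (p ∘ suc))

length-concatMap : ∀ {A B : Set} (F : A → List B) xs {X} →
                   All (λ a → length (F a) ≡ X) xs → length (concatMap F xs) ≡ length xs * X
length-concatMap F []       []               = refl
length-concatMap F (x ∷ xs) (Fx≡X ∷ Fxs≡X) =
  trans (length-++ (F x)) (cong₂ ℕ._+_ Fx≡X (length-concatMap F xs Fxs≡X))

-- Products of factorials

∏-scale : ∀ {k} (h h′ : Fin k → ℕ) i a → h i ≡ a * h′ i → (∀ j → j ≢ i → h j ≡ h′ j) →
          ∏ h ≡ a * ∏ h′
∏-scale h h′ zero a hi≡ah′i others = begin
  h zero * ∏ (h ∘ suc)          ≡⟨ cong₂ _*_ hi≡ah′i (∏-cong (λ j → others (suc j) λ ())) ⟩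
  a * h′ zero * ∏ (h′ ∘ suc)    ≡⟨ ℕ.*-assoc a _ _ ⟩
  a * ∏ h′                      ∎
  where open ≡-Reasoning
∏-scale h h′ (suc i) a hi≡ah′i others = begin
  h zero * ∏ (h ∘ suc)          ≡⟨ cong₂ _*_ (others zero λ ())
                                     (∏-scale (h ∘ suc) (h′ ∘ suc) i a hi≡ah′i
                                        (λ j j≢i → others (suc j) (j≢i ∘ suc-injective))) ⟩
  h′ zero * (a * ∏ (h′ ∘ suc))  ≡⟨ x∙yz≈y∙xz (h′ zero) a _ ⟩
  a * ∏ h′                      ∎
  where open ≡-Reasoning

product-map-ones : ∀ (g : ℕ → ℕ) ts → All (λ t → g t ≡ 1) ts → product (map g ts) ≡ 1
product-map-ones g []       []             = refl
product-map-ones g (t ∷ ts) (gt≡1 ∷ gts≡1) =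
  cong₂ _*_ gt≡1 (product-map-ones g ts gts≡1)

product-map-* : ∀ (g h : ℕ → ℕ) ts →
                product (map (λ t → g t * h t) ts) ≡ product (map g ts) * product (map h ts)
product-map-* g h []       = refl
product-map-* g h (t ∷ ts) = begin
  g t * h t * product (map (λ t → g t * h t) ts)           ≡⟨ cong (g t * h t *_) (product-map-* g h ts) ⟩
  g t * h t * (product (map g ts) * product (map h ts))    ≡⟨ interchange (g t) (h t) _ _ ⟩
  g t * product (map g ts) * (h t * product (map h ts))    ∎
  where open ≡-Reasoning

factorial-power : ℕ → ℕ → ℕ
factorial-power a t = (t !) ^ toℕᵇ (does (a ℕ.≟ t))

product-factorial-power : ∀ a ts → Unique ts → a ≡ 0 ⊎ a ∈ˡ ts →
                          product (map (factorial-power a) ts) ≡ a !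
product-factorial-power a ts _ (inj₁ refl) =
  product-map-ones (factorial-power 0) ts (All.universal zero-case ts)
  where
  zero-case : ∀ t → factorial-power 0 t ≡ 1
  zero-case zero    = refl
  zero-case (suc t) = refl
product-factorial-power a (a ∷ ts) (a∉ts ∷ _) (inj₂ (here refl))
  rewrite dec-true (a ℕ.≟ a) refl =
  trans (cong₂ _*_ (ℕ.*-identityʳ (a !))
                   (product-map-ones (factorial-power a) ts
                      (All.map (λ {t} a≢t → cong (λ b → (t !) ^ toℕᵇ b) (dec-false (a ℕ.≟ t) a≢t)) a∉ts)))
        (ℕ.*-identityʳ (a !))
product-factorial-power a (t ∷ ts) (a∉ts ∷ ts-unique) (inj₂ (there a∈ts))
  rewrite dec-false (a ℕ.≟ t) (λ a≡t → All.lookup a∉ts a∈ts (sym a≡t)) =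
  trans (ℕ.+-identityʳ _) (product-factorial-power a ts ts-unique (inj₂ a∈ts))

-- Groups the factors of ∏_b (v b)! by the value t = v b; the value 0 contributes 0! = 1.
product-factorial-powers : ∀ {k} (v : Fin k → ℕ) ts → Unique ts → (∀ b → v b ≡ 0 ⊎ v b ∈ˡ ts) →
  product (map (λ t → (t !) ^ count (λ b → does (v b ℕ.≟ t))) ts) ≡ ∏ (λ b → v b !)
product-factorial-powers {zero}  v ts _         _      = product-map-ones _ ts (All.universal (λ _ → refl) ts)
product-factorial-powers {suc k} v ts ts-unique covers = begin
  product (map (λ t → (t !) ^ count (λ b → does (v b ℕ.≟ t))) ts)
    ≡⟨ cong product (map-cong split-head ts) ⟩
  product (map (λ t → factorial-power (v zero) t * rest t) ts)
    ≡⟨ product-map-* (factorial-power (v zero)) rest ts ⟩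
  product (map (factorial-power (v zero)) ts) * product (map rest ts)
    ≡⟨ cong₂ _*_ (product-factorial-power (v zero) ts ts-unique (covers zero))
                 (product-factorial-powers (v ∘ suc) ts ts-unique (covers ∘ suc)) ⟩
  v zero ! * ∏ (λ b → v (suc b) !)
    ∎
  where
  open ≡-Reasoning
  rest = λ t → (t !) ^ count (λ b → does (v (suc b) ℕ.≟ t))
  split-head : ∀ t → (t !) ^ count (λ b → does (v b ℕ.≟ t)) ≡ factorial-power (v zero) t * rest t
  split-head t = trans (cong ((t !) ^_) (count-head (λ b → does (v b ℕ.≟ t))))
                       (ℕ.^-distribˡ-+-* (t !) (toℕᵇ (does (v zero ℕ.≟ t))) _)

≤-foldr-⊔ : ∀ {x xs} → x ∈ˡ xs → x ≤ foldr _⊔_ 0 xs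
≤-foldr-⊔ (here refl)   = ℕ.m≤m⊔n _ _
≤-foldr-⊔ (there x∈xs) = ℕ.≤-trans (≤-foldr-⊔ x∈xs) (ℕ.m≤n⊔m _ _)

multiplicity≡∏ : ∀ {n} (f : Fin n → Fin n) → multiplicity f ≡ ∏ (λ c → #Pre f c !)
multiplicity≡∏ f = product-factorial-powers (#Pre f) (map suc (upTo (u f)))
  (Unique.map⁺ ℕ.suc-injective (Unique.upTo⁺ (u f))) covers
  where
  covers : ∀ c → #Pre f c ≡ 0 ⊎ #Pre f c ∈ˡ map suc (upTo (u f))
  covers c with #Pre f c | ≤-foldr-⊔ (∈-map⁺ (#Pre f) (∈-allFin c))
  ... | zero  | _        = inj₁ refl
  ... | suc t | t<u = inj₂ (∈-map⁺ suc (∈-upTo⁺ t<u))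

-- Functions realising a table

module _ {n : ℕ} where

  -- Corresponds G f g A is, by definition, IsGraph f (λ x → g x + f x) A.
  IsGraph : ∀ {m} → (Fin m → Fin n) → (Fin m → Fin n) → Subtable → Set
  IsGraph f σ T = ∀ r c → T r c ≡ true ⇔ (∃ λ x → f x ≡ c × σ x ≡ r)

  InjectiveOnFibres : ∀ {m} → (Fin m → Fin n) → (Fin m → Fin n) → Set
  InjectiveOnFibres f σ = ∀ x y → x ≢ y → f x ≡ f y → σ x ≢ σ y

  Realises : ∀ {m} → (Fin m → Fin n) → (Fin m → Fin n) → Subtable → Set
  Realises f σ T = IsGraph f σ T × InjectiveOnFibres f σ

  #fibre : ∀ {m} → (Fin m → Fin n) → Fin n → ℕ
  #fibre f c = count (λ x → does (f x ≟ c))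

  Balanced : ∀ {m} → (Fin m → Fin n) → Subtable → Set
  Balanced f T = ∀ c → #rows T c ≡ #fibre f c

  removeEntry : Subtable → Fin n → Fin n → Subtable
  removeEntry T r₀ c₀ r c = T r c ∧ not (does (r ≟ r₀) ∧ does (c ≟ c₀))

  removeEntry-true : ∀ T r₀ c₀ r c →
                     removeEntry T r₀ c₀ r c ≡ true ⇔ (T r c ≡ true × ¬ (r ≡ r₀ × c ≡ c₀))
  removeEntry-true T r₀ c₀ r c with T r c | r ≟ r₀ | c ≟ c₀
  ... | true  | yes r≡r₀ | yes c≡c₀ = mk⇔ (λ ()) (λ (_ , ≢) → contradiction (r≡r₀ , c≡c₀) ≢)
  ... | true  | yes _    | no  c≢c₀ = mk⇔ (λ _ → refl , c≢c₀ ∘ proj₂) (λ _ → refl)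
  ... | true  | no  r≢r₀ | _        = mk⇔ (λ _ → refl , r≢r₀ ∘ proj₁) (λ _ → refl)
  ... | false | _        | _        = mk⇔ (λ ()) (λ ())

  removeEntry-column : ∀ T r₀ c₀ r → removeEntry T r₀ c₀ r c₀ ≡ ((λ r′ → T r′ c₀) without r₀) r
  removeEntry-column T r₀ c₀ r =
    cong (λ b → T r c₀ ∧ not b)
         (trans (cong (does (r ≟ r₀) ∧_) (dec-true (c₀ ≟ c₀) refl)) (∧-identityʳ _))

  removeEntry-otherColumn : ∀ T r₀ c₀ r {c} → c ≢ c₀ → removeEntry T r₀ c₀ r c ≡ T r c
  removeEntry-otherColumn T r₀ c₀ r {c} c≢c₀ = begin
    T r c ∧ not (does (r ≟ r₀) ∧ does (c ≟ c₀))  ≡⟨ cong (λ b → T r c ∧ not (does (r ≟ r₀) ∧ b))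
                                                         (dec-false (c ≟ c₀) c≢c₀) ⟩
    T r c ∧ not (does (r ≟ r₀) ∧ false)          ≡⟨ cong (λ b → T r c ∧ not b) (∧-zeroʳ _) ⟩
    T r c ∧ true                                 ≡⟨ ∧-identityʳ _ ⟩
    T r c                                        ∎
    where open ≡-Reasoning

  #rows-removeEntry : ∀ T r₀ c₀ → T r₀ c₀ ≡ true →
                      ∀ c → #rows T c ≡ toℕᵇ (does (c₀ ≟ c)) ℕ.+ #rows (removeEntry T r₀ c₀) c
  #rows-removeEntry T r₀ c₀ t c with c₀ ≟ c
  ... | yes refl = trans (count-without (λ r → T r c₀) r₀ t)
                         (cong suc (count-cong (sym ∘ removeEntry-column T r₀ c₀)))
  ... | no c₀≢c  = count-cong (λ r → sym (removeEntry-otherColumn T r₀ c₀ r (c₀≢c ∘ sym)))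

  balanced-removeEntry : ∀ {m} (f : Fin (suc m) → Fin n) T r → T r (f zero) ≡ true →
                         Balanced f T ⇔ Balanced (f ∘ suc) (removeEntry T r (f zero))
  balanced-removeEntry f T r t = mk⇔
    (λ bal c → ℕ.+-cancelˡ-≡ (δ c) _ _ (trans (sym (rows c)) (trans (bal c) (fibre c))))
    (λ bal′ c → trans (rows c) (trans (cong (δ c ℕ.+_) (bal′ c)) (sym (fibre c))))
    where
    δ = λ c → toℕᵇ (does (f zero ≟ c))
    rows = #rows-removeEntry T r (f zero) t
    fibre = λ c → count-head (λ x → does (f x ≟ c))

  realises⇔removeHead : ∀ {m} (f σ : Fin (suc m) → Fin n) T →
    Realises f σ T ⇔ (T (σ zero) (f zero) ≡ true × Realises (f ∘ suc) (σ ∘ suc) (removeEntry T (σ zero) (f zero)))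
  realises⇔removeHead f σ T = mk⇔ detach attach
    where
    T′ = removeEntry T (σ zero) (f zero)
    removed = λ r c → removeEntry-true T (σ zero) (f zero) r c

    detach : Realises f σ T → T (σ zero) (f zero) ≡ true × Realises (f ∘ suc) (σ ∘ suc) T′
    detach (graph , inj) = from (graph _ _) (zero , refl , refl) , graph′ , inj′
      where
      graph′ : IsGraph (f ∘ suc) (σ ∘ suc) T′
      graph′ r c = mk⇔
        (λ t′ → case-tail (proj₂ (to (removed r c) t′)) (to (graph r c) (proj₁ (to (removed r c) t′))))
        (λ (x , fx≡c , σx≡r) → from (removed r c)
          ( from (graph r c) (suc x , fx≡c , σx≡r)
          , λ (r≡σ0 , c≡f0) → inj (suc x) zero (λ ()) (trans fx≡c c≡f0) (trans σx≡r r≡σ0)))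
        where
        case-tail : ¬ (r ≡ σ zero × c ≡ f zero) → (∃ λ x → f x ≡ c × σ x ≡ r) →
                    ∃ λ x → f (suc x) ≡ c × σ (suc x) ≡ r
        case-tail not-head (zero  , f0≡c , σ0≡r) = contradiction (sym σ0≡r , sym f0≡c) not-head
        case-tail not-head (suc x , fx≡c , σx≡r) = x , fx≡c , σx≡r
      inj′ : InjectiveOnFibres (f ∘ suc) (σ ∘ suc)
      inj′ x y x≢y = inj (suc x) (suc y) (x≢y ∘ suc-injective)

    attach : T (σ zero) (f zero) ≡ true × Realises (f ∘ suc) (σ ∘ suc) T′ → Realises f σ T
    attach (t , graph′ , inj′) = graph , inj
      where
      not-head : ∀ x → ¬ (σ (suc x) ≡ σ zero × f (suc x) ≡ f zero)
      not-head x = proj₂ (to (removed _ _) (from (graph′ _ _) (x , refl , refl)))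
      graph : IsGraph f σ T
      graph r c = mk⇔ in-graph graph-in
        where
        graph-in : (∃ λ x → f x ≡ c × σ x ≡ r) → T r c ≡ true
        graph-in (zero  , refl , refl) = t
        graph-in (suc x , fx≡c , σx≡r) = proj₁ (to (removed r c) (from (graph′ r c) (x , fx≡c , σx≡r)))
        in-tail : T r c ≡ true × ¬ (r ≡ σ zero × c ≡ f zero) → ∃ λ x → f x ≡ c × σ x ≡ r
        in-tail entry = let (x , fx≡c , σx≡r) = to (graph′ r c) (from (removed r c) entry) in suc x , fx≡c , σx≡r
        in-graph : T r c ≡ true → ∃ λ x → f x ≡ c × σ x ≡ r
        in-graph trc with r ≟ σ zero | c ≟ f zero
        ... | yes r≡σ0 | yes c≡f0 = zero , sym c≡f0 , sym r≡σ0
        ... | yes _    | no c≢f0  = in-tail (trc , c≢f0 ∘ proj₂)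
        ... | no r≢σ0  | _        = in-tail (trc , r≢σ0 ∘ proj₁)
      inj : InjectiveOnFibres f σ
      inj zero    zero    0≢0 _         _         = 0≢0 refl
      inj zero    (suc y) _   f0≡fy     σ0≡σy     = not-head y (sym σ0≡σy , sym f0≡fy)
      inj (suc x) zero    _   fx≡f0     σx≡σ0     = not-head x (σx≡σ0 , fx≡f0)
      inj (suc x) (suc y) x≢y fx≡fy     σx≡σy     = inj′ x y (x≢y ∘ cong suc) fx≡fy σx≡σy

  realises⇒balanced : ∀ {m} (f σ : Fin m → Fin n) T → Realises f σ T → Balanced f T
  realises⇒balanced {zero}  f σ T (graph , _) c =
    count-false (λ r → T r c) (λ r → ¬-not (no-entry r))
    where
    no-entry : ∀ r → T r c ≢ true
    no-entry r trc with () ← proj₁ (to (graph r c) trc)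
  realises⇒balanced {suc m} f σ T realises =
    let (t , realises′) = to (realises⇔removeHead f σ T) realises
    in from (balanced-removeEntry f T (σ zero) t)
         (realises⇒balanced (f ∘ suc) (σ ∘ suc) _ realises′)

  realisations : ∀ {m} → (Fin m → Fin n) → Subtable → List (Fin m → Fin n)
  extensions : ∀ {m} → (Fin (suc m) → Fin n) → Subtable → Fin n → List (Fin (suc m) → Fin n)

  realisations {zero}  f T = [ (λ ()) ]
  realisations {suc m} f T = concatMap (extensions f T) (trueIndices (λ r → T r (f zero)))

  extensions f T r = map (r ∷ᶠ_) (realisations (f ∘ suc) (removeEntry T r (f zero)))

  length-realisations : ∀ {m} (f : Fin m → Fin n) T → Balanced f T →
                        length (realisations f T) ≡ ∏ (λ c → #fibre f c !)
  length-realisations {zero}  f T _   = sym (∏-replicate-one n)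
  length-realisations {suc m} f T bal = begin
    length (realisations f T)     ≡⟨ length-concatMap (extensions f T) rs
                                       (All.map length-extensions (trueIndices-true _)) ⟩
    length rs * ∏ fibres′         ≡⟨ cong (_* ∏ fibres′)
                                       (trans (length-trueIndices (λ r → T r (f zero))) (bal (f zero))) ⟩
    #fibre f (f zero) * ∏ fibres′ ≡⟨ ∏-scale fibres fibres′ (f zero) (#fibre f (f zero)) at-head elsewhere ⟨
    ∏ fibres                      ∎
    where
    open ≡-Reasoning
    f′ = f ∘ suc
    fibres = λ c → #fibre f c !
    fibres′ = λ c → #fibre f′ c !
    rs = trueIndices (λ r → T r (f zero))
    length-extensions : ∀ {r} → T r (f zero) ≡ true → length (extensions f T r) ≡ ∏ fibres′
    length-extensions {r} t = trans (length-map (r ∷ᶠ_) (realisations f′ (removeEntry T r (f zero))))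
      (length-realisations f′ _ (to (balanced-removeEntry f T r t) bal))
    at-head : #fibre f (f zero) ! ≡ #fibre f (f zero) * #fibre f′ (f zero) !
    at-head rewrite count-head (λ x → does (f x ≟ f zero)) | dec-true (f zero ≟ f zero) refl = refl
    elsewhere : ∀ c → c ≢ f zero → #fibre f c ! ≡ #fibre f′ c !
    elsewhere c c≢f0 rewrite count-head (λ x → does (f x ≟ c)) | dec-false (f zero ≟ c) (c≢f0 ∘ sym) = refl

  realisations-unique : ∀ {m} (f : Fin m → Fin n) T → AllPairs (λ σ τ → ¬ σ ≗ τ) (realisations f T)
  realisations-unique {zero}  f T = [] ∷ []
  realisations-unique {suc m} f T =
    AllPairs.concat⁺ (All.map⁺ (All.universal extensions-unique rs))
                     (AllPairs.map⁺ (AllPairs.map different-heads (trueIndices-unique _)))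
    where
    rs = trueIndices (λ r → T r (f zero))
    extensions-unique : ∀ r → AllPairs (λ σ τ → ¬ σ ≗ τ) (extensions f T r)
    extensions-unique r = AllPairs.map⁺ (AllPairs.map (λ σ≉τ σ≗τ → σ≉τ (σ≗τ ∘ suc))
                                                      (realisations-unique (f ∘ suc) _))
    different-heads : ∀ {r r′} → r ≢ r′ →
      All (λ σ → All (λ τ → ¬ σ ≗ τ) (extensions f T r′)) (extensions f T r)
    different-heads r≢r′ =
      All.map⁺ (All.universal (λ _ → All.map⁺ (All.universal (λ _ σ≗τ → r≢r′ (σ≗τ zero)) _)) _)

  realisations-complete : ∀ {m} (f σ : Fin m → Fin n) T → Realises f σ T → Any (σ ≗_) (realisations f T)
  realisations-complete {zero}  f σ T _         = here (λ ())
  realisations-complete {suc m} f σ T realises =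
    Any.concatMap⁺ (extensions f T)
      (Any.map (λ { refl → Any.map⁺ (Any.map (∷-cong refl) tail-found) }) (∈-trueIndices (λ r → T r (f zero)) t))
    where
    detached = to (realises⇔removeHead f σ T) realises
    t = proj₁ detached
    tail-found = realisations-complete (f ∘ suc) (σ ∘ suc) _ (proj₂ detached)

  realisations-sound : ∀ {m} (f σ : Fin m → Fin n) T → Balanced f T →
                       Any (σ ≗_) (realisations f T) → Realises f σ T
  realisations-sound {zero}  f σ T bal _ = (λ r c → mk⇔ (no-entry r c) (λ ())) , (λ ())
    where
    no-entry : ∀ r c → T r c ≡ true → ∃ λ x → f x ≡ c × σ x ≡ r
    no-entry r c trc with () ← trans (sym (count-without (λ r → T r c) r trc)) (bal c)
  realisations-sound {suc m} f σ T bal found =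
    let (t , found-extension) = All.lookupAny (trueIndices-true _) (Any.concatMap⁻ (extensions f T) found)
    in attach _ t found-extension
    where
    attach : ∀ r → T r (f zero) ≡ true → Any (σ ≗_) (extensions f T r) → Realises f σ T
    attach r t found-extension with refl ← proj₂ (Any.satisfied (Any.map⁻ found-extension)) zero =
      from (realises⇔removeHead f σ T)
        (t , realisations-sound (f ∘ suc) (σ ∘ suc) _
               (to (balanced-removeEntry f T (σ zero) t) bal)
               (Any.map (_∘ suc) (Any.map⁻ found-extension)))

  isGraph-unique : ∀ {m} {f σ : Fin m → Fin n} {A B} → IsGraph f σ A → IsGraph f σ B → SameSubtable A B
  isGraph-unique graphA graphB r c = ≡true⇔≡true⇒≡ (⇔.trans (graphA r c) (⇔.sym (graphB r c)))

  graphTable : ∀ {m} → (Fin m → Fin n) → (Fin m → Fin n) → Subtable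
  graphTable f σ r c = does (any? λ x → (f x ≟ c) ×-dec (σ x ≟ r))

  isGraph-graphTable : ∀ {m} (f σ : Fin m → Fin n) → IsGraph f σ (graphTable f σ)
  isGraph-graphTable f σ r c = does≡true⇔ (any? λ x → (f x ≟ c) ×-dec (σ x ≟ r))

-- The subtraction table

toGroup : ∀ {n} → FinGroup n → Group 0ℓ 0ℓ
toGroup G = record { isGroup = isGroup }
  where open FinGroup G

module _ {n : ℕ} (G : FinGroup n) (f : Fin n → Fin n) where
  open FinGroup G
  -- x // y in toGroup G unfolds to x - y.
  open GroupProperties (toGroup G) using (//-rightDividesˡ; //-rightDividesʳ; ∙-cancelʳ)

  injectiveOnFibres-shift : ∀ g → InjectiveOnFibres f g ⇔ InjectiveOnFibres f (λ x → g x + f x)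
  injectiveOnFibres-shift g = mk⇔
    (λ inj x y x≢y fx≡fy → inj x y x≢y fx≡fy ∘ ∙-cancelʳ (f y) (g x) (g y)
                                             ∘ trans (cong (g x +_) (sym fx≡fy)))
    (λ inj x y x≢y fx≡fy gx≡gy → inj x y x≢y fx≡fy (cong₂ _+_ gx≡gy fx≡fy))

  inIm⇔isValue : ∀ {g A} → Corresponds G f g A →
                 ∀ b → InIm g b ⇔ (∃₂ λ r c → A r c ≡ true × r - c ≡ b)
  inIm⇔isValue {g} corr b = mk⇔
    (λ (x , gx≡b) → g x + f x , f x , from (corr _ _) (x , refl , refl)
                  , trans (//-rightDividesʳ (f x) (g x)) gx≡b)
    (λ (r , c , arc , r-c≡b) → let (x , fx≡c , gx+fx≡r) = to (corr r c) arc in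
      x , trans (sym (//-rightDividesʳ (f x) (g x))) (trans (cong₂ _-_ gx+fx≡r fx≡c) r-c≡b))

  inIm-shift⇔isRow : ∀ {g A} → Corresponds G f g A →
                     ∀ r → InIm (λ x → g x + f x) r ⇔ (∃ λ c → A r c ≡ true)
  inIm-shift⇔isRow corr r = mk⇔
    (λ (x , gx+fx≡r) → f x , from (corr r (f x)) (x , refl , gx+fx≡r))
    (λ (c , arc) → let (x , _ , gx+fx≡r) = to (corr r c) arc in x , gx+fx≡r)

  ≗-unshift⇔ : ∀ g σ → g ≗ (λ x → σ x - f x) ⇔ (λ x → g x + f x) ≗ σ
  ≗-unshift⇔ g σ = mk⇔
    (λ g≗σ-f x → trans (cong (_+ f x) (g≗σ-f x)) (//-rightDividesˡ (f x) (σ x)))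
    (λ g+f≗σ x → trans (sym (//-rightDividesʳ (f x) (g x))) (cong (_- f x) (g+f≗σ x)))

  module _ (S : Subset n) where

    good×corresponds⇔realises : ∀ {g A} → (∀ s → s ∈ S ⇔ (∃₂ λ r c → A r c ≡ true × r - c ≡ s)) →
      (Good f S g × Corresponds G f g A) ⇔ Realises f (λ x → g x + f x) A
    good×corresponds⇔realises {g} values = mk⇔
      (λ ((_ , inj) , corr) → corr , to (injectiveOnFibres-shift g) inj)
      (λ (graph , inj) → ( (λ b → ⇔.trans (inIm⇔isValue graph b) (⇔.sym (values b)))
                         , from (injectiveOnFibres-shift g) inj)
                       , graph)

    admissible⇒balanced : ∀ {A} → Admissible G f S A → Balanced f A
    admissible⇒balanced {A} (sub , _ , rows) c with any? (λ x → f x ≟ c)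
    ... | yes c∈Im = rows c c∈Im
    ... | no  c∉Im = trans (count-false _ λ r → ¬-not (c∉Im ∘ sub r c))
                           (sym (count-false _ λ x → dec-false (f x ≟ c) (c∉Im ∘ (x ,_))))

    subtable-of-good : ∀ g → Good f S g →
      Σ Subtable λ A → Admissible G f S A × Corresponds G f g A
        × (∀ B → Corresponds G f g B → SameSubtable A B)
    subtable-of-good g (image , inj) = A , (sub , values , balanced) , corr , λ _ → isGraph-unique corr
      where
      σ = λ x → g x + f x
      A = graphTable f σ
      corr = isGraph-graphTable f σ
      sub : IsSubtableOf f A
      sub r c arc = let (x , fx≡c , _) = to (corr r c) arc in x , fx≡c
      values = λ s → ⇔.trans (⇔.sym (image s)) (inIm⇔isValue corr s)
      balanced = λ c _ → realises⇒balanced f σ A (corr , to (injectiveOnFibres-shift g) inj) c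

    good-functions-of-admissible : ∀ A → Admissible G f S A →
      HasExactly (λ g → Good f S g × Corresponds G f g A) (multiplicity f)
    good-functions-of-admissible A adm@(_ , values , _) = map unshift R , length≡ , distinct , members
      where
      unshift = λ σ x → σ x - f x
      R = realisations f A
      balanced = admissible⇒balanced adm

      length≡ : length (map unshift R) ≡ multiplicity f
      length≡ = begin
        length (map unshift R)   ≡⟨ length-map unshift R ⟩
        length R                 ≡⟨ length-realisations f A balanced ⟩
        ∏ (λ c → #Pre f c !)     ≡⟨ multiplicity≡∏ f ⟨
        multiplicity f           ∎
        where open ≡-Reasoning

      distinct : AllPairs (λ g h → ¬ g ≗ h) (map unshift R)
      distinct = AllPairs.map⁺ (AllPairs.map (λ σ≉τ σ-f≗τ-f → σ≉τ λ x → ∙-cancelʳ (- f x) _ _ (σ-f≗τ-f x))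
                                             (realisations-unique f A))

      members : ∀ g → (Good f S g × Corresponds G f g A) ⇔ Any (g ≗_) (map unshift R)
      members g = ⇔.trans (good×corresponds⇔realises values)
                 (⇔.trans (mk⇔ (realisations-complete f _ A) (realisations-sound f _ A balanced))
                          (mk⇔ (Any.map⁺ ∘ Any.map (from (≗-unshift⇔ g _)))
                               (Any.map (to (≗-unshift⇔ g _)) ∘ Any.map⁻)))

  corresponding-same-images : ∀ {A g h} → Corresponds G f g A → Corresponds G f h A →
    SameIm g h × SameIm (λ x → g x + f x) (λ x → h x + f x)
  corresponding-same-images cg ch =
    (λ b → ⇔.trans (inIm⇔isValue cg b) (⇔.sym (inIm⇔isValue ch b))) ,
    (λ r → ⇔.trans (inIm-shift⇔isRow cg r) (⇔.sym (inIm-shift⇔isRow ch r)))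

lemma2p1 : ∀ {n} (G : FinGroup n) (f : Fin n → Fin n) (k : ℕ) (S : Subset n)
    → ∣ S ∣ ≡ k → u f ≤ k
    → (∀ g → Good f S g →
         Σ Subtable λ A → Admissible G f S A × Corresponds G f g A
           × (∀ B → Corresponds G f g B → SameSubtable A B))
    × (∀ A → Admissible G f S A →
         HasExactly (λ g → Good f S g × Corresponds G f g A) (multiplicity f))
    × (∀ A g h → Admissible G f S A → Corresponds G f g A → Corresponds G f h A →
         SameIm g h × SameIm (λ x → FinGroup._+_ G (g x) (f x)) (λ x → FinGroup._+_ G (h x) (f x)))
lemma2p1 G f k S _ _ =
  subtable-of-good G f S ,
  good-functions-of-admissible G f S ,
  λ A g h _ → corresponding-same-images G f
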